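{- Let $m\geq 2$ and $k\geq1$ be natural numbers, put $n=m+k-1$, and let $\mathcal{F}_k\subseteq\binom{[n]}{k+1}$ be the family defined recursively by $$\mathcal{F}_1=\big\{\{2t-1,2t\}: t\in\mathbb{N},\ 1\leq t\leq \tfrac{m}{2}\big\}\cup\big\{\{m-1,m\}\big\}\subseteq\binom{[m]}{2},$$ $$\mathcal{F}_{j+1}=\bigcup_{i=1}^{m+j}\big\{S\cup\{i\}: S\in\mathcal{F}_j\cap 2^{[i-1]}\big\}\subseteq\binom{[m+j]}{j+2}\quad(j\geq1).$$ Then: (1) $\mathcal{F}_k$ has the $k$-covering property (every $k$-element subset of $[n]$ is contained in a member of $\mathcal{F}_k$); (2) $\mathcal{F}_k$ has the unique face property; (3) for every $\{t_1,\dots,t_{k+1}\}\in\mathcal{F}_k$ with $t_1<\dots<t_{k+1}$ and every $\hat t\in[n]$ with $t_k<\hat t<t_{k+1}$, we have $\{t_1,\dots,t_k,\hat t\}\in\mathcal{F}_k$; (4) if $2k<n$ then the set $\{n-k+1,\dots,n\}$ is shattered by $\mathcal{F}_k$.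
   Context: $[n]=\{1,\dots,n\}$ (with $[0]=\emptyset$), $\binom{[n]}{s}$ is the set of $s$-element subsets of $[n]$, and $2^{X}$ is the power set of $X$. A set $A$ is shattered by a family $\mathcal{F}$ if $\{A\cap S: S\in\mathcal{F}\}=2^A$. A family $\mathcal{F}\subseteq\binom{[n]}{s}$ has the unique face property if for every $S\in\mathcal{F}$ there is a proper subset $K\subsetneq S$ such that $S$ is the only member of $\mathcal{F}$ containing $K$. -}

module Defs where

open import Data.Nat using (ℕ; zero; suc; _+_; _*_; _∸_; _/_; _<_; _≤_; _<?_)
open import Data.List using (List; []; _∷_; _++_; [_]; map; concatMap; filter; applyUpTo; length)
open import Data.List.Relation.Unary.All using (all?)
open import Data.List.Membership.Propositional using (_∈_; _∉_)
open import Data.List.Relation.Binary.Subset.Propositional using (_⊆_)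
open import Data.List.Relation.Unary.Unique.Propositional using (Unique)
open import Data.Product using (Σ; ∃; ∃-syntax; _×_)
open import Function.Bundles using (_⇔_)
open import Relation.Binary.PropositionalEquality using (_≡_)

-- Convention: a finite set of naturals is a list; the members of the families
-- F_k below are strictly increasing lists (canonical representatives), so
-- list membership / equality of members is set membership / equality.

segment : ℕ → ℕ → List ℕ
segment a len = applyUpTo (a +_) len

F₁ : ℕ → List (List ℕ)
F₁ m = map (λ t → (2 * t ∸ 1) ∷ (2 * t) ∷ []) (segment 1 (m / 2))
       ++ [ (m ∸ 1) ∷ m ∷ [] ]

step : ℕ → ℕ → List (List ℕ) → List (List ℕ)
step m j Fj = concatMap (λ i → map (λ S → S ++ [ i ]) (filter (λ S → all? (_<? i) S) Fj))
                        (segment 1 (m + j))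

-- F m k = F_k for the parameter m (k ≥ 1); F m 0 is an unused dummy.
F : ℕ → ℕ → List (List ℕ)
F m zero = []
F m (suc zero) = F₁ m
F m (suc (suc j)) = step m (suc j) (F m (suc j))

InRange : ℕ → List ℕ → Set
InRange n A = ∀ {x} → x ∈ A → 1 ≤ x × x ≤ n

KCovering : ℕ → ℕ → List (List ℕ) → Set
KCovering n k 𝓕 = ∀ (A : List ℕ) → Unique A → length A ≡ k → InRange n A →
                  ∃[ S ] (S ∈ 𝓕 × A ⊆ S)

UniqueFace : List (List ℕ) → Set
UniqueFace 𝓕 = ∀ {S} → S ∈ 𝓕 →
  ∃[ K ] ((K ⊆ S × ∃[ x ] (x ∈ S × x ∉ K)) ×
          (∀ {S'} → S' ∈ 𝓕 → K ⊆ S' → S' ≡ S))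

Shattered : List ℕ → List (List ℕ) → Set
Shattered A 𝓕 = ∀ (B : List ℕ) → B ⊆ A →
  ∃[ S ] (S ∈ 𝓕 × (∀ x → x ∈ A → ((x ∈ S) ⇔ (x ∈ B))))

{-# OPTIONS --safe #-}
module Submission where

-- In the paper's indexing, F_k consists exactly of the (k+1)-subsets of [m+k-1] whose two
-- smallest elements form a pair of F_1: each step of the recursion adds a new maximum
-- i ≤ m+k-1, and removing the maximum of such a set goes one step back. Admissible m k is this
-- closed form of F m (suc k).
-- Covering: every x ≤ m lies in a pair of F_1; by induction on a bound M of A, the part of A
-- below M is covered inside [1, M], and then M is appended (or M+1 if M is already used).
-- Unique face: every pair has a private element q lying in no other pair (its odd element 2t-1,
-- or m for {m-1, m}). If S = {a, b} ∪ I and S' ⊇ {q} ∪ I, then q is among the two smallest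
-- elements of S' and I lies above them, because an increasing list contained in another one is
-- a sublist of it and the lengths leave no room.
-- Part (3) is one step of the recursion. {m, …, m+k-1} is shattered: B = A is cut out by
-- {m-1} ∪ A, and any other B by {1, …, k+1-|B|} ∪ B, which stays below m because 2k < n.

open import Defs
open import Data.Nat using (ℕ; zero; suc; _+_; _*_; _∸_; _/_; _<_; _≤_; _<?_; _≟_; z≤n; s≤s; NonZero)
open import Data.Nat.Properties
open import Data.Nat.DivMod using (m*n/n≡m; /-monoˡ-≤; m/n*n≤m)
open import Data.List using (List; []; _∷_; _++_; [_]; _∷ʳ_; map; filter; length; initLast; _∷ʳ′_)
open import Data.List.Properties using (length-++; length-applyUpTo; ∷ʳ-injective; ∷ʳ-++; filter-notAll)
open import Data.List.Membership.Propositional using (_∈_; _∉_)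
open import Data.List.Membership.Propositional.Properties
  using (∈-++⁺ˡ; ∈-++⁺ʳ; ∈-++⁻; ∈-map⁺; ∈-map⁻; ∈-concat⁺′; ∈-concat⁻′; ∈-filter⁺; ∈-filter⁻;
         ∈-applyUpTo⁺; ∈-applyUpTo⁻)
open import Data.List.Membership.DecPropositional _≟_ using (_∈?_)
open import Data.List.Relation.Binary.Subset.Propositional using (_⊆_)
open import Data.List.Relation.Binary.Sublist.Propositional as Sublist
  using () renaming (_⊆_ to _⊑_)
open import Data.List.Relation.Binary.Sublist.Heterogeneous.Properties using (length-mono-≤; toPointwise)
open import Data.List.Relation.Binary.Pointwise using (Pointwise-≡⇒≡)
open import Data.List.Relation.Unary.All as All using (All; []; _∷_; all?)
open import Data.List.Relation.Unary.All.Properties using (¬All⇒Any¬; ++⁺; ∷ʳ⁺; ∷ʳ⁻)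
open import Data.List.Relation.Unary.AllPairs using (AllPairs; []; _∷_)
import Data.List.Relation.Unary.AllPairs.Properties as AllPairs
open import Data.List.Relation.Unary.Any as Any using (here; there)
open import Data.Product using (∃-syntax; _×_; _,_; proj₁; proj₂; map₂)
open import Data.Sum using (_⊎_; inj₁; inj₂)
open import Function.Base using (_∘_)
open import Function.Bundles using (mk⇔)
open import Relation.Nullary using (¬_; yes; no; contradiction)
open import Relation.Binary using (Rel; tri<; tri≈; tri>)
open import Relation.Binary.PropositionalEquality using (_≡_; refl; sym; trans; cong; subst; subst₂)

Even : ℕ → Set
Even n = ∃[ t ] n ≡ 2 * t

even⊎odd : ∀ n → Even n ⊎ Even (suc n)
even⊎odd zero = inj₁ (0 , refl)
even⊎odd (suc n) with even⊎odd n
... | inj₁ (t , refl) = inj₂ (suc t , sym (*-suc 2 t))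
... | inj₂ even       = inj₁ even

even⇒¬odd : ∀ {n} → Even n → ¬ Even (suc n)
even⇒¬odd (t , refl) (s , eq) = even≢odd s t (sym eq)

length-∷ʳ : ∀ {a} {A : Set a} (xs : List A) x → length (xs ∷ʳ x) ≡ suc (length xs)
length-∷ʳ xs x = trans (length-++ xs) (+-comm (length xs) 1)

module _ {a ℓ} {A : Set a} {R : Rel A ℓ} where

  AllPairs-∷ʳ⁺ : ∀ {xs y} → AllPairs R xs → All (λ x → R x y) xs → AllPairs R (xs ∷ʳ y)
  AllPairs-∷ʳ⁺ xs↑ xs<y = AllPairs.++⁺ xs↑ ([] ∷ []) (All.map (_∷ []) xs<y)

  AllPairs-∷ʳ⁻ : ∀ xs {y} → AllPairs R (xs ∷ʳ y) → AllPairs R xs × All (λ x → R x y) xs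
  AllPairs-∷ʳ⁻ []       _                  = [] , []
  AllPairs-∷ʳ⁻ (x ∷ xs) (x<xs∷ʳy ∷ xs∷ʳy↑) =
    let xs↑ , xs<y = AllPairs-∷ʳ⁻ xs xs∷ʳy↑
        x<xs , x<y = ∷ʳ⁻ x<xs∷ʳy
    in  x<xs ∷ xs↑ , x<y ∷ xs<y

head-≤ : ∀ {x xs z} → All (x <_) xs → z ∈ x ∷ xs → x ≤ z
head-≤ _    (here refl)  = ≤-refl
head-≤ x<xs (there z∈xs) = <⇒≤ (All.lookup x<xs z∈xs)

ascending-⊆⇒⊑ : ∀ {xs ys} → AllPairs _<_ xs → AllPairs _<_ ys → xs ⊆ ys → xs ⊑ ys
ascending-⊆⇒⊑ {[]}     {ys}    _ _ _ = Sublist.minimum ys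
ascending-⊆⇒⊑ {x ∷ xs} {[]}    _ _ x∷xs⊆[] with x∷xs⊆[] (here refl)
... | ()
ascending-⊆⇒⊑ {x ∷ xs} {y ∷ ys} (x<xs ∷ xs↑) (y<ys ∷ ys↑) x∷xs⊆y∷ys with <-cmp x y
... | tri< x<y _ _ = contradiction (head-≤ y<ys (x∷xs⊆y∷ys (here refl))) (<⇒≱ x<y)
... | tri≈ _ refl _ = refl Sublist.∷ ascending-⊆⇒⊑ xs↑ ys↑ λ z∈xs →
  Any.tail (>⇒≢ (All.lookup x<xs z∈xs)) (x∷xs⊆y∷ys (there z∈xs))
... | tri> _ _ y<x = y Sublist.∷ʳ ascending-⊆⇒⊑ (x<xs ∷ xs↑) ys↑ λ z∈x∷xs →
  Any.tail (>⇒≢ (<-≤-trans y<x (head-≤ x<xs z∈x∷xs))) (x∷xs⊆y∷ys z∈x∷xs)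

∈-dropPair : ∀ {a b z I} → a < b → b < z → z ∈ a ∷ b ∷ I → z ∈ I
∈-dropPair a<b b<z z∈ = Any.tail (>⇒≢ b<z) (Any.tail (>⇒≢ (<-trans a<b b<z)) z∈)

∈-segment⁻ : ∀ {a n x} → x ∈ segment a n → a ≤ x × x < a + n
∈-segment⁻ {a} x∈ with ∈-applyUpTo⁻ (a +_) x∈
... | i , i<n , refl = m≤m+n a i , +-monoʳ-< a i<n

∈-segment⁺ : ∀ {a n x} → a ≤ x → x < a + n → x ∈ segment a n
∈-segment⁺ {a} {n} a≤x x<a+n = subst (_∈ segment a n) (m+[n∸m]≡n a≤x)
  (∈-applyUpTo⁺ (a +_) (+-cancelˡ-< a _ _ (subst (_< a + n) (sym (m+[n∸m]≡n a≤x)) x<a+n)))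

segment-ascending : ∀ a n → AllPairs _<_ (segment a n)
segment-ascending a n = AllPairs.applyUpTo⁺₁ (a +_) n (λ i<j _ → +-monoʳ-< a i<j)

∈-F₁⁻ : ∀ {m} .{{_ : NonZero m}} {S} → S ∈ F₁ m →
        ∃[ a ] (S ≡ a ∷ suc a ∷ [] × suc a ≤ m × (Even (suc a) ⊎ suc a ≡ m))
∈-F₁⁻ {m@(suc _)} S∈ with ∈-++⁻ (map _ (segment 1 (m / 2))) S∈
... | inj₂ (here refl) = _ , refl , ≤-refl , inj₂ refl
... | inj₁ S∈pairs with ∈-map⁻ _ S∈pairs
...   | t , t∈ , refl with ∈-segment⁻ t∈
-- matching t = suc _ is what lets 2 * t ∸ 1 compute to the predecessor of 2 * t
...     | s≤s _ , t≤m/2 = _ , refl , 2t≤m , inj₁ (t , refl)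
  where
  2t≤m : 2 * t ≤ m
  2t≤m = ≤-trans (*-monoʳ-≤ 2 (≤-pred t≤m/2)) (subst (_≤ m) (*-comm (m / 2) 2) (m/n*n≤m m 2))

∈-F₁⁺ : ∀ {m a t} → suc a ≡ 2 * t → suc a ≤ m → a ∷ suc a ∷ [] ∈ F₁ m
∈-F₁⁺ {m} {t = suc t} 1+a≡2t 1+a≤m with suc-injective 1+a≡2t
... | refl = ∈-++⁺ˡ (∈-map⁺ _ (∈-segment⁺ (s≤s z≤n) (s≤s t≤m/2)))
  where
  t≤m/2 : suc t ≤ m / 2
  t≤m/2 = subst (_≤ m / 2) (trans (cong (_/ 2) (*-comm 2 (suc t))) (m*n/n≡m (suc t) 2))
                (/-monoˡ-≤ 2 1+a≤m)

∈-F₁-last : ∀ {m} → (m ∸ 1) ∷ m ∷ [] ∈ F₁ m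
∈-F₁-last {m} = ∈-++⁺ʳ (map _ (segment 1 (m / 2))) (here refl)

pair∈F₁⇒< : ∀ {m} .{{_ : NonZero m}} {a b} → a ∷ b ∷ [] ∈ F₁ m → a < b
pair∈F₁⇒< ab∈F₁ with ∈-F₁⁻ ab∈F₁
... | _ , refl , _ = ≤-refl

pair∈F₁⇒≤ : ∀ {m} .{{_ : NonZero m}} {a b} → a ∷ b ∷ [] ∈ F₁ m → b ≤ m
pair∈F₁⇒≤ ab∈F₁ with ∈-F₁⁻ ab∈F₁
... | _ , refl , b≤m , _ = b≤m

F₁-covers : ∀ {m x} → 1 ≤ x → x ≤ m →
            ∃[ a ] (a ∷ suc a ∷ [] ∈ F₁ m × x ∈ a ∷ suc a ∷ [] × suc a ≤ suc x)
F₁-covers {m} {suc x} _ 1+x≤m with even⊎odd (suc x)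
... | inj₁ (t , 1+x≡2t) = x , ∈-F₁⁺ {t = t} 1+x≡2t 1+x≤m , there (here refl) , n≤1+n _
... | inj₂ (t , 2+x≡2t) with suc (suc x) ≤? m
...   | yes 2+x≤m = suc x , ∈-F₁⁺ {t = t} 2+x≡2t 2+x≤m , here refl , ≤-refl
...   | no  2+x≰m with ≤-antisym 1+x≤m (≮⇒≥ 2+x≰m)
...     | refl = x , ∈-F₁-last , there (here refl) , n≤1+n _

F₁-last-private : ∀ {a S′} → S′ ∈ F₁ (suc a) → suc a ∈ S′ → S′ ≡ a ∷ suc a ∷ []
F₁-last-private S′∈F₁ 1+a∈S′ with ∈-F₁⁻ S′∈F₁
... | _ , refl , 2+a≤1+a , _ with 1+a∈S′
...   | here refl         = contradiction 2+a≤1+a 1+n≰n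
...   | there (here refl) = refl

F₁-odd-private : ∀ {m} .{{_ : NonZero m}} {a S′} → Even (suc a) → suc a ≤ m →
                 S′ ∈ F₁ m → a ∈ S′ → S′ ≡ a ∷ suc a ∷ []
F₁-odd-private even 1+a≤m S′∈F₁ a∈S′ with ∈-F₁⁻ S′∈F₁
... | _ , refl , _ , top′ with a∈S′ | top′
...   | here refl         | _          = refl
...   | there (here refl) | inj₁ even′ = contradiction even (even⇒¬odd even′)
...   | there (here refl) | inj₂ refl  = contradiction 1+a≤m 1+n≰n

F₁-private : ∀ {m} .{{_ : NonZero m}} {S} → S ∈ F₁ m →
             ∃[ q ] (q ∈ S × ∀ {S′} → S′ ∈ F₁ m → q ∈ S′ → S′ ≡ S)
F₁-private S∈F₁ with ∈-F₁⁻ S∈F₁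
... | a , refl , 1+a≤m , inj₁ even = a , here refl , F₁-odd-private even 1+a≤m
... | a , refl , _     , inj₂ refl = suc a , there (here refl) , F₁-last-private

∈-step⁺ : ∀ {m j 𝓕 P i} → P ∈ 𝓕 → All (_< i) P → 1 ≤ i → i ≤ m + j → P ∷ʳ i ∈ step m j 𝓕
∈-step⁺ P∈𝓕 P<i 1≤i i≤m+j =
  ∈-concat⁺′ (∈-map⁺ _ (∈-filter⁺ _ P∈𝓕 P<i)) (∈-map⁺ _ (∈-segment⁺ 1≤i (s≤s i≤m+j)))

∈-step⁻ : ∀ {m j 𝓕 S} → S ∈ step m j 𝓕 →
          ∃[ P ] ∃[ i ] (S ≡ P ∷ʳ i × P ∈ 𝓕 × All (_< i) P × i ≤ m + j)
∈-step⁻ {m} {j} {𝓕} S∈ with ∈-concat⁻′ (map _ (segment 1 (m + j))) S∈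
... | _ , S∈Ss , Ss∈ with ∈-map⁻ (λ i → map (_∷ʳ i) (filter (λ S → all? (_<? i) S) 𝓕)) Ss∈
...   | i , i∈ , refl with ∈-map⁻ (_∷ʳ i) S∈Ss
...     | P , P∈ , refl with ∈-filter⁻ (λ S → all? (_<? i) S) P∈
...       | P∈𝓕 , P<i = P , i , refl , P∈𝓕 , P<i , ≤-pred (proj₂ (∈-segment⁻ i∈))

data Admissible (m k : ℕ) : List ℕ → Set where
  admissible : ∀ {a b I} → a ∷ b ∷ [] ∈ F₁ m → All (b <_) I → AllPairs _<_ I →
               All (_≤ m + k) I → length I ≡ k → Admissible m k (a ∷ b ∷ I)

Admissible⇒ascending : ∀ {m} .{{_ : NonZero m}} {k S} → Admissible m k S → AllPairs _<_ S
Admissible⇒ascending (admissible ab∈F₁ b<I I↑ _ _) =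
  (a<b ∷ All.map (<-trans a<b) b<I) ∷ b<I ∷ I↑
  where a<b = pair∈F₁⇒< ab∈F₁

Admissible⇒bounded : ∀ {m} .{{_ : NonZero m}} {k S} → Admissible m k S → All (_≤ m + k) S
Admissible⇒bounded {m} {k} (admissible ab∈F₁ _ _ I≤ _) =
  <⇒≤ (<-≤-trans (pair∈F₁⇒< ab∈F₁) b≤) ∷ b≤ ∷ I≤
  where b≤ = ≤-trans (pair∈F₁⇒≤ ab∈F₁) (m≤m+n m k)

Admissible-∷ʳ : ∀ {m k S i} → Admissible m k S → All (_< i) S → i ≤ m + suc k →
                Admissible m (suc k) (S ∷ʳ i)
Admissible-∷ʳ {m} {k} {i = i} (admissible {I = I} ab∈F₁ b<I I↑ I≤ |I|≡k) (_ ∷ b<i ∷ I<i) i≤ =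
  admissible ab∈F₁ (∷ʳ⁺ b<I b<i) (AllPairs-∷ʳ⁺ I↑ I<i)
    (∷ʳ⁺ (All.map (λ x≤ → ≤-trans x≤ (+-monoʳ-≤ m (n≤1+n k))) I≤) i≤)
    (trans (length-∷ʳ I i) (cong suc |I|≡k))

∈F⇒Admissible : ∀ {m} .{{_ : NonZero m}} k {S} → S ∈ F m (suc k) → Admissible m k S
∈F⇒Admissible zero S∈F₁ with ∈-F₁⁻ S∈F₁
... | _ , refl , _ = admissible S∈F₁ [] [] [] refl
∈F⇒Admissible {m} (suc k) S∈F with ∈-step⁻ {m} {suc k} S∈F
... | _ , _ , refl , P∈F , P<i , i≤ = Admissible-∷ʳ (∈F⇒Admissible k P∈F) P<i i≤

Admissible⇒∈F : ∀ {m} .{{_ : NonZero m}} k {S} → Admissible m k S → S ∈ F m (suc k)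
Admissible⇒∈F zero (admissible {I = []} ab∈F₁ _ _ _ _) = ab∈F₁
Admissible⇒∈F {m} (suc k) (admissible {I = I} ab∈F₁ b<I I↑ I≤ |I|≡1+k) with initLast I
Admissible⇒∈F {m} (suc k) (admissible ab∈F₁ b<I I↑ I≤ ())       | []
Admissible⇒∈F {m} (suc k) (admissible ab∈F₁ b<I I↑ I≤ |I|≡1+k) | J ∷ʳ′ i =
  let b<J , b<i = ∷ʳ⁻ b<I
      J↑ , J<i  = AllPairs-∷ʳ⁻ J I↑
      i≤        = proj₂ (∷ʳ⁻ I≤)
      a<i       = <-trans (pair∈F₁⇒< ab∈F₁) b<i
      J≤        = All.map (λ x<i → ≤-pred (≤-trans x<i (subst (i ≤_) (+-suc m k) i≤))) J<i
      |J|≡k     = suc-injective (trans (sym (length-∷ʳ J i)) |I|≡1+k)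
  in  ∈-step⁺ {m} {suc k} (Admissible⇒∈F k (admissible ab∈F₁ b<J J↑ J≤ |J|≡k))
              (a<i ∷ b<i ∷ J<i) (≤-trans (s≤s z≤n) a<i) i≤

segment-++-admissible : ∀ {m k u J} → 2 ≤ m → AllPairs _<_ J → All (2 + u <_) J →
                        All (_≤ m + k) J → u + length J ≡ k →
                        Admissible m k (segment 1 (2 + u) ++ J)
segment-++-admissible {m} {k} {u} {J} 2≤m J↑ 2+u<J J≤ u+|J|≡k =
  admissible (∈-F₁⁺ {t = 1} refl 2≤m)
    (++⁺ (All.tabulate (proj₁ ∘ bounds)) (All.map (≤-<-trans (m≤m+n 2 u)) 2+u<J))
    (AllPairs.++⁺ (segment-ascending 3 u) J↑
      (All.tabulate λ x∈ → All.map (≤-<-trans (proj₂ (bounds x∈))) 2+u<J))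
    (++⁺ (All.tabulate λ x∈ → ≤-trans (proj₂ (bounds x∈)) (+-mono-≤ 2≤m u≤k)) J≤)
    (trans (length-++ (segment 3 u)) (trans (cong (_+ length J) (length-applyUpTo (3 +_) u)) u+|J|≡k))
  where
  bounds : ∀ {x} → x ∈ segment 3 u → 2 < x × x ≤ 2 + u
  bounds x∈ = map₂ ≤-pred (∈-segment⁻ x∈)
  u≤k : u ≤ k
  u≤k = ≤-trans (m≤m+n u (length J)) (≤-reflexive u+|J|≡k)

CoveredWithin : ℕ → ℕ → ℕ → List ℕ → Set
CoveredWithin m k M A = ∃[ S ] (Admissible m k S × A ⊆ S × All (_≤ suc M) S)

segment-covers : ∀ {m} → 2 ≤ m → ∀ k {M A} → InRange (suc k) A → suc k ≤ M → CoveredWithin m k M A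
segment-covers 2≤m k A⊆ 1+k≤M =
  segment 1 (2 + k) ++ [] , segment-++-admissible 2≤m [] [] [] (+-identityʳ k) ,
  (λ x∈A → let 1≤x , x≤1+k = A⊆ x∈A in ∈-++⁺ˡ (∈-segment⁺ 1≤x (s≤s (m≤n⇒m≤1+n x≤1+k)))) ,
  ++⁺ (All.tabulate λ x∈ → ≤-trans (≤-pred (proj₂ (∈-segment⁻ x∈))) (s≤s 1+k≤M)) []

Admissible-extend : ∀ {m} .{{_ : NonZero m}} {k M S} → Admissible m k S → All (_≤ M) S →
                    M ≤ m + suc k →
                    ∃[ S⁺ ] (Admissible m (suc k) S⁺ × S ⊆ S⁺ × M ∈ S⁺ × All (_≤ suc M) S⁺)
Admissible-extend {m} {k} {M} {S} S-adm S≤M M≤ with M ∈? S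
... | no M∉S = S ∷ʳ M , Admissible-∷ʳ S-adm S<M M≤ , ∈-++⁺ˡ , ∈-++⁺ʳ S (here refl) ,
               ∷ʳ⁺ (All.map m≤n⇒m≤1+n S≤M) (n≤1+n M)
  where S<M = All.tabulate λ x∈S → ≤∧≢⇒< (All.lookup S≤M x∈S) λ { refl → M∉S x∈S }
... | yes M∈S = S ∷ʳ suc M , Admissible-∷ʳ S-adm (All.map s≤s S≤M) 1+M≤ , ∈-++⁺ˡ , ∈-++⁺ˡ M∈S ,
                ∷ʳ⁺ (All.map m≤n⇒m≤1+n S≤M) ≤-refl
  where 1+M≤ = subst (suc M ≤_) (sym (+-suc m k)) (s≤s (All.lookup (Admissible⇒bounded S-adm) M∈S))

CoveredWithin-extend : ∀ {m} .{{_ : NonZero m}} {k M A} → InRange (suc M) A → suc M ≤ m + suc k →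
                       CoveredWithin m k M (filter (_<? suc M) A) → CoveredWithin m (suc k) (suc M) A
CoveredWithin-extend {M = M} {A} A⊆ 1+M≤ (_ , S′-adm , A′⊆S′ , S′≤1+M)
  with Admissible-extend S′-adm S′≤1+M 1+M≤
... | S , S-adm , S′⊆S , 1+M∈S , S≤2+M = S , S-adm , A⊆S , S≤2+M
  where
  A⊆S : A ⊆ S
  A⊆S {x} x∈A with x <? suc M
  ... | yes x<1+M = S′⊆S (A′⊆S′ (∈-filter⁺ (_<? suc M) x∈A x<1+M))
  ... | no  x≮1+M = subst (_∈ S) (≤-antisym (≮⇒≥ x≮1+M) (proj₂ (A⊆ x∈A))) 1+M∈S

cover : ∀ {m} .{{_ : NonZero m}} → 2 ≤ m → ∀ k M {A} → InRange M A → length A ≤ suc k →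
        suc k ≤ M → M ≤ m + k → CoveredWithin m k M A
cover 2≤m zero M {[]} _ _ 1≤M _ = segment-covers 2≤m zero (λ ()) 1≤M
cover {m} 2≤m zero M {x ∷ []} A⊆ _ _ M≤m+0 =
  let 1≤x , x≤M = A⊆ (here refl)
      a , ab∈F₁ , x∈ab , 1+a≤1+x = F₁-covers 1≤x (≤-trans x≤M (subst (M ≤_) (+-identityʳ m) M≤m+0))
      1+a≤1+M = ≤-trans 1+a≤1+x (s≤s x≤M)
  in  a ∷ suc a ∷ [] , admissible ab∈F₁ [] [] [] refl , (λ { (here refl) → x∈ab }) ,
      m≤n⇒m≤1+n (≤-pred 1+a≤1+M) ∷ 1+a≤1+M ∷ []
cover 2≤m zero M {_ ∷ _ ∷ _} _ (s≤s ()) _ _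
cover {m} 2≤m (suc k) (suc M) {A} A⊆ |A|≤2+k 2+k≤1+M 1+M≤ with suc k <? M | suc M ∈? A
... | no 1+k≮M | _ =
  segment-covers 2≤m (suc k) (λ x∈A → map₂ (λ x≤1+M → ≤-trans x≤1+M (s≤s (≮⇒≥ 1+k≮M))) (A⊆ x∈A))
                 2+k≤1+M
... | yes 1+k<M | no 1+M∉A =
  let S , S-adm , A⊆S , S≤1+M = cover 2≤m (suc k) M A⊆M |A|≤2+k 1+k<M (≤-trans (n≤1+n M) 1+M≤)
  in  S , S-adm , A⊆S , All.map m≤n⇒m≤1+n S≤1+M
  where
  A⊆M : InRange M A
  A⊆M x∈A = map₂ (λ x≤1+M → ≤-pred (≤∧≢⇒< x≤1+M λ { refl → 1+M∉A x∈A })) (A⊆ x∈A)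
... | yes 1+k<M | yes 1+M∈A =
  CoveredWithin-extend A⊆ 1+M≤ (cover 2≤m k M A′⊆M |A′|≤1+k (≤-pred 2+k≤1+M) M≤m+k)
  where
  A′ = filter (_<? suc M) A
  A′⊆M : InRange M A′
  A′⊆M x∈A′ = let x∈A , x<1+M = ∈-filter⁻ (_<? suc M) x∈A′ in proj₁ (A⊆ x∈A) , ≤-pred x<1+M
  |A′|≤1+k : length A′ ≤ suc k
  |A′|≤1+k = ≤-pred (≤-trans (filter-notAll (_<? suc M) A (Any.map (λ { refl → n≮n _ }) 1+M∈A))
                             |A|≤2+k)
  M≤m+k : M ≤ m + k
  M≤m+k = ≤-pred (subst (suc M ≤_) (+-suc m k) 1+M≤)

covering : ∀ {m} → 2 ≤ m → ∀ k → KCovering (m + k) (suc k) (F m (suc k))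
covering {m} 2≤m@(s≤s _) k A _ |A|≡1+k A⊆ =
  let S , S-adm , A⊆S , _ = cover 2≤m k (m + k) A⊆ (≤-reflexive |A|≡1+k) 1+k≤m+k ≤-refl
  in  S , Admissible⇒∈F k S-adm , A⊆S
  where 1+k≤m+k = +-monoˡ-≤ k (≤-trans (s≤s z≤n) 2≤m)

properFace : ∀ {a b q I} → a < b → All (b <_) I → q ∈ a ∷ b ∷ [] →
             q ∷ I ⊆ a ∷ b ∷ I × ∃[ x ] (x ∈ a ∷ b ∷ I × x ∉ q ∷ I)
properFace {a} {b} {I = I} a<b b<I q∈ab = K⊆S , other q∈ab
  where
  K⊆S : _ ∷ I ⊆ a ∷ b ∷ I
  K⊆S (here refl) = ∈-++⁺ˡ q∈ab
  K⊆S (there z∈I) = there (there z∈I)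
  other : ∀ {q} → q ∈ a ∷ b ∷ [] → ∃[ x ] (x ∈ a ∷ b ∷ I × x ∉ q ∷ I)
  other (here refl)         = b , there (here refl) , λ
    { (here b≡a) → <-irrefl (sym b≡a) a<b ; (there b∈I) → n≮n b (All.lookup b<I b∈I) }
  other (there (here refl)) = a , here refl , λ
    { (here a≡b) → <-irrefl a≡b a<b ; (there a∈I) → <-asym a<b (All.lookup b<I a∈I) }

face-determines : ∀ {m} .{{_ : NonZero m}} {k a b q I S′} → Admissible m k (a ∷ b ∷ I) →
                  q ∈ a ∷ b ∷ [] → (∀ {P} → P ∈ F₁ m → q ∈ P → P ≡ a ∷ b ∷ []) →
                  Admissible m k S′ → q ∷ I ⊆ S′ → S′ ≡ a ∷ b ∷ I
face-determines {k = k} {a} {b} {q} {I} (admissible ab∈F₁ b<I I↑ _ |I|≡k) q∈ab q-private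
                (admissible {a′} {b′} {I′} a′b′∈F₁ b′<I′ I′↑ _ |I′|≡k) K⊆S′
  with ∈-++⁻ (a′ ∷ b′ ∷ []) (K⊆S′ (here refl))
... | inj₂ q∈I′ = contradiction (subst₂ _≤_ (cong suc |I|≡k) |I′|≡k |K|≤|I′|) 1+n≰n
  where
  q<I : All (q <_) I
  q<I = All.map (≤-<-trans (All.lookup (<⇒≤ (pair∈F₁⇒< ab∈F₁) ∷ ≤-refl ∷ []) q∈ab)) b<I
  K⊆I′ : q ∷ I ⊆ I′
  K⊆I′ z∈K = ∈-dropPair (pair∈F₁⇒< a′b′∈F₁) (<-≤-trans (All.lookup b′<I′ q∈I′) (head-≤ q<I z∈K))
                        (K⊆S′ z∈K)
  |K|≤|I′| : suc (length I) ≤ length I′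
  |K|≤|I′| = length-mono-≤ (ascending-⊆⇒⊑ (q<I ∷ I↑) I′↑ K⊆I′)
... | inj₁ q∈a′b′ with q-private a′b′∈F₁ q∈a′b′
...   | refl = cong (λ J → a ∷ b ∷ J)
                    (sym (Pointwise-≡⇒≡ (toPointwise |I|≡|I′| (ascending-⊆⇒⊑ I↑ I′↑ I⊆I′))))
  where
  I⊆I′ : I ⊆ I′
  I⊆I′ z∈I = ∈-dropPair (pair∈F₁⇒< a′b′∈F₁) (All.lookup b<I z∈I) (K⊆S′ (there z∈I))
  |I|≡|I′| = trans |I|≡k (sym |I′|≡k)

uniqueFace : ∀ {m} .{{_ : NonZero m}} k → UniqueFace (F m (suc k))
uniqueFace k S∈F with ∈F⇒Admissible k S∈F
... | S-adm@(admissible ab∈F₁ b<I _ _ _) with F₁-private ab∈F₁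
...   | q , q∈ab , q-private =
  q ∷ _ , properFace (pair∈F₁⇒< ab∈F₁) b<I q∈ab ,
  λ S′∈F K⊆S′ → face-determines S-adm q∈ab q-private (∈F⇒Admissible k S′∈F) K⊆S′

lowerLast : ∀ {m} .{{_ : NonZero m}} k T a b c → T ++ a ∷ b ∷ [] ∈ F m (suc k) →
            a < c → c < b → c ≤ m + k → T ++ a ∷ c ∷ [] ∈ F m (suc k)
lowerLast zero T a b c S∈F₁ a<c c<b _ with ∈-F₁⁻ S∈F₁
... | a′ , eq , _ with ∷ʳ-injective (T ∷ʳ a) [ a′ ] (trans (∷ʳ-++ T a [ b ]) eq)
...   | T∷ʳa≡[a′] , refl with ∷ʳ-injective T [] T∷ʳa≡[a′]
...     | _ , refl = contradiction (≤-pred c<b) (<⇒≱ a<c)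
lowerLast {m} (suc k) T a b c S∈F a<c c<b c≤
  with ∈-step⁻ {m} {suc k} (subst (_∈ F m (2 + k)) (sym (∷ʳ-++ T a [ b ])) S∈F)
... | P , _ , eq , P∈F , _ with ∷ʳ-injective (T ∷ʳ a) P eq
...   | refl , refl =
  subst (_∈ F m (2 + k)) (∷ʳ-++ T a [ c ]) (∈-step⁺ {m} {suc k} P∈F P<c (≤-trans (s≤s z≤n) a<c) c≤)
  where
  T<a : All (_< a) T
  T<a = proj₂ (AllPairs-∷ʳ⁻ T (Admissible⇒ascending (∈F⇒Admissible k P∈F)))
  P<c : All (_< c) (T ∷ʳ a)
  P<c = ∷ʳ⁺ (All.map (λ t<a → <-trans t<a a<c) T<a) a<c

top-admissible : ∀ {m} k → Admissible m k ((m ∸ 1) ∷ m ∷ segment (suc m) k)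
top-admissible {m} k =
  admissible ∈-F₁-last (All.tabulate (proj₁ ∘ ∈-segment⁻)) (segment-ascending (suc m) k)
    (All.tabulate (≤-pred ∘ proj₂ ∘ ∈-segment⁻)) (length-applyUpTo (suc m +_) k)

segment⊆top : ∀ {m} k → segment m (suc k) ⊆ (m ∸ 1) ∷ m ∷ segment (suc m) k
segment⊆top {m} k {x} x∈A with ∈-segment⁻ x∈A
... | m≤x , x<m+1+k with m≤n⇒m<n∨m≡n m≤x
...   | inj₁ m<x  = there (there (∈-segment⁺ m<x (subst (x <_) (+-suc m k) x<m+1+k)))
...   | inj₂ refl = there (here refl)

shattered : ∀ {m} k → 3 + k ≤ m → Shattered (segment m (suc k)) (F m (suc k))
shattered {m} k 3+k≤m@(s≤s _) B _ with all? (_∈? B) (segment m (suc k))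
... | yes A⊆B = (m ∸ 1) ∷ m ∷ segment (suc m) k , Admissible⇒∈F k (top-admissible k) ,
                λ x x∈A → mk⇔ (λ _ → All.lookup A⊆B x∈A) (λ _ → segment⊆top k x∈A)
... | no A⊈B = segment 1 (2 + u) ++ Bs , Admissible⇒∈F k S-adm ,
               λ x x∈A → mk⇔ (S∩A⊆B x∈A) (B∩A⊆S x∈A)
  where
  A = segment m (suc k)
  Bs = filter (_∈? B) A
  |Bs|≤k : length Bs ≤ k
  |Bs|≤k = ≤-pred (subst (length Bs <_) (length-applyUpTo (m +_) (suc k))
                     (filter-notAll (_∈? B) A (¬All⇒Any¬ (_∈? B) A A⊈B)))
  u = k ∸ length Bs
  3+u≤m : 3 + u ≤ m
  3+u≤m = ≤-trans (s≤s (s≤s (s≤s (m∸n≤m k (length Bs))))) 3+k≤m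
  Bs⊆A : Bs ⊆ A
  Bs⊆A = proj₁ ∘ ∈-filter⁻ (_∈? B)
  S-adm : Admissible m k (segment 1 (2 + u) ++ Bs)
  S-adm = segment-++-admissible (≤-trans (s≤s (s≤s z≤n)) 3+k≤m)
            (AllPairs.filter⁺ (_∈? B) (segment-ascending m (suc k)))
            (All.tabulate λ x∈Bs → <-≤-trans 3+u≤m (proj₁ (∈-segment⁻ (Bs⊆A x∈Bs))))
            (All.tabulate λ {x} x∈Bs → ≤-pred (subst (x <_) (+-suc m k) (proj₂ (∈-segment⁻ (Bs⊆A x∈Bs)))))
            (m∸n+n≡m |Bs|≤k)
  S∩A⊆B : ∀ {x} → x ∈ A → x ∈ segment 1 (2 + u) ++ Bs → x ∈ B
  S∩A⊆B x∈A x∈S with ∈-++⁻ (segment 1 (2 + u)) x∈S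
  ... | inj₁ x∈low = contradiction (proj₁ (∈-segment⁻ x∈A))
                                   (<⇒≱ (<-≤-trans (proj₂ (∈-segment⁻ x∈low)) 3+u≤m))
  ... | inj₂ x∈Bs  = proj₂ (∈-filter⁻ (_∈? B) x∈Bs)
  B∩A⊆S : ∀ {x} → x ∈ A → x ∈ B → x ∈ segment 1 (2 + u) ++ Bs
  B∩A⊆S x∈A x∈B = ∈-++⁺ʳ (segment 1 (2 + u)) (∈-filter⁺ (_∈? B) x∈A x∈B)

mainTheorem8 : ∀ (m k : ℕ) → 2 ≤ m → 1 ≤ k →
    KCovering (m + k ∸ 1) k (F m k)
    × UniqueFace (F m k)
    × (∀ (T : List ℕ) (a b c : ℕ) → (T ++ a ∷ b ∷ []) ∈ F m k →
         a < c → c < b → c ≤ m + k ∸ 1 → (T ++ a ∷ c ∷ []) ∈ F m k)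
    × (2 * k < m + k ∸ 1 → Shattered (segment (m + k ∸ 1 ∸ k + 1) k) (F m k))
mainTheorem8 m@(suc m′) (suc k) 2≤m _ rewrite +-suc m′ k =
  covering 2≤m k ,
  uniqueFace k ,
  lowerLast k ,
  λ 2+2k<m+k → subst (λ a → Shattered (segment a (suc k)) (F m (suc k))) (sym start≡m)
                     (shattered k (+-cancelʳ-≤ k (3 + k) m (subst (_≤ m + k) 1+2[1+k]≡3+k+k 2+2k<m+k)))
  where
  start≡m : m + k ∸ suc k + 1 ≡ m
  start≡m = trans (cong (_+ 1) (m+n∸n≡m m′ k)) (+-comm m′ 1)
  1+2[1+k]≡3+k+k : suc (2 * suc k) ≡ 3 + k + k
  1+2[1+k]≡3+k+k = cong suc (trans (*-suc 2 k) (cong (λ z → 2 + (k + z)) (+-identityʳ k)))
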